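{- $(\mathbb{F}_2,\leq_2)$ is distributive: if $f$ is a function and $(g_i)_{i\in I}$ a set-indexed family of functions with $f\leq_2\lceil g_i\rceil_{i\in I}$, then there is a family of functions $(f_i)_{i\in I}$ with $f_i\leq_2 g_i$ for all $i\in I$ and $f\equiv_2\lceil f_i\rceil_{i\in I}$.
   Context: All functions are between topological spaces. A partial function $F:\subseteq X\to Y$ is continuous if continuous on $\operatorname{dom}(F)$ with the subspace topology. For functions $f:\underline{X}_1\to\underline{Y}_1$, $g:\underline{X}_2\to\underline{Y}_2$, $f\leq_2 g$ means there are continuous partial functions $F:\subseteq\underline{X}_1\times\underline{Y}_2\to\underline{Y}_1$ and $G:\subseteq\underline{X}_1\to\underline{X}_2$ with $f(x)=F(x,g(G(x)))$ (all defined) for all $x\in X_1$; $\equiv_2$ is the induced equivalence and $\mathbb{F}_2$ the class of equivalence classes. The coproduct $\coprod_{i\in I}\underline{X}_i$ is $\bigcup_i\{i\}\times X_i$ with the smallest topology containing all $\{i\}\times U$, $U$ open in $\underline{X}_i$; for $g_i:\underline{X}_i\to\underline{Y}_i$, $\lceil g_i\rceil_{i\in I}(i,x)=(i,g_i(x))$ defines $\lceil g_i\rceil_{i\in I}:\coprod_i\underline{X}_i\to\coprod_i\underline{Y}_i$. It is known that $\lceil g_i\rceil_{i\in I}$ is the supremum of the $g_i$ in $(\mathbb{F}_2,\leq_2)$. A complete join-semilattice is called distributive iff $x\leq\sup_{i\in I}y_i$ implies the existence of $(x_i)_{i\in I}$ with $x_i\leq y_i$ for all $i$ and $x=\sup_{i\in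 I}x_i$. -}

module Defs where

open import Level using (Level; 0ℓ) renaming (suc to lsuc)
open import Data.Product using (Σ; Σ-syntax; _×_; _,_; proj₁; proj₂)
open import Data.Unit using (⊤)
open import Relation.Binary.PropositionalEquality using (_≡_; subst)

Subset : Set → Set₁
Subset A = A → Set

_≐_ : {A : Set} → Subset A → Subset A → Set
U ≐ V = ∀ x → (U x → V x) × (V x → U x)

record Space : Set₂ where
  field
    Carrier  : Set
    Open     : Subset Carrier → Set₁
    open-ext : ∀ {U V} → Open U → U ≐ V → Open V
    open-⊤   : Open (λ _ → ⊤)
    open-∩   : ∀ {U V} → Open U → Open V → Open (λ x → U x × V x)
    open-⋃   : (J : Set) (U : J → Subset Carrier) →
               (∀ j → Open (U j)) → Open (λ x → Σ[ j ∈ J ] U j x)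
open Space public

data Gen {A : Set} (B : Subset A → Set₁) : Subset A → Set₁ where
  gen-base : ∀ {U} → B U → Gen B U
  gen-ext  : ∀ {U V} → Gen B U → U ≐ V → Gen B V
  gen-⊤    : Gen B (λ _ → ⊤)
  gen-∩    : ∀ {U V} → Gen B U → Gen B V → Gen B (λ x → U x × V x)
  gen-⋃    : (J : Set) (U : J → Subset A) →
             (∀ j → Gen B (U j)) → Gen B (λ x → Σ[ j ∈ J ] U j x)

generated : (A : Set) → (Subset A → Set₁) → Space
generated A B = record
  { Carrier  = A
  ; Open     = Gen B
  ; open-ext = gen-ext
  ; open-⊤   = gen-⊤
  ; open-∩   = gen-∩
  ; open-⋃   = gen-⋃
  }

ProdBase : (X Y : Space) → Subset (Carrier X × Carrier Y) → Set₁
ProdBase X Y W = Σ[ U ∈ Subset (Carrier X) ] Σ[ V ∈ Subset (Carrier Y) ]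
  (Open X U × Open Y V × (W ≐ (λ p → U (proj₁ p) × V (proj₂ p))))

_⊗_ : Space → Space → Space
X ⊗ Y = generated (Carrier X × Carrier Y) (ProdBase X Y)

ΣC : {I : Set} → (I → Space) → Set
ΣC {I} X = Σ[ i ∈ I ] Carrier (X i)

-- the subset {i} × U
inj-set : {I : Set} (X : I → Space) (i : I) → Subset (Carrier (X i)) → Subset (ΣC X)
inj-set X i U (j , x) = Σ[ e ∈ j ≡ i ] U (subst (λ k → Carrier (X k)) e x)

CoprodBase : {I : Set} (X : I → Space) → Subset (ΣC X) → Set₁
CoprodBase {I} X W = Σ[ i ∈ I ] Σ[ U ∈ Subset (Carrier (X i)) ]
  (Open (X i) U × (W ≐ inj-set X i U))

∐ : {I : Set} → (I → Space) → Space
∐ X = generated (ΣC X) (CoprodBase X)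

⌈_⌉ : {I : Set} {X Y : I → Space} →
      ((i : I) → Carrier (X i) → Carrier (Y i)) → Carrier (∐ X) → Carrier (∐ Y)
⌈ g ⌉ (i , x) = (i , g i x)

record PFun (X Y : Space) : Set₁ where
  field
    dom : Subset (Carrier X)
    app : (x : Carrier X) → .(dom x) → Carrier Y
open PFun public

-- Continuity on dom(F) with the subspace topology: the preimage of every
-- open V ⊆ Y is open in dom(F), i.e. is the trace U ∩ dom(F) of some open U of X.
ContinuousP : {X Y : Space} → PFun X Y → Set₁
ContinuousP {X} {Y} F =
  ∀ (V : Subset (Carrier Y)) → Open Y V →
    Σ[ U ∈ Subset (Carrier X) ] (Open X U ×
      (∀ x (d : dom F x) → (V (app F x d) → U x) × (U x → V (app F x d))))

_≤₂_ : {X₁ Y₁ X₂ Y₂ : Space} →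
       (Carrier X₁ → Carrier Y₁) → (Carrier X₂ → Carrier Y₂) → Set₁
_≤₂_ {X₁} {Y₁} {X₂} {Y₂} f g =
  Σ[ F ∈ PFun (X₁ ⊗ Y₂) Y₁ ] Σ[ G ∈ PFun X₁ X₂ ]
    (ContinuousP F × ContinuousP G ×
      (∀ x → Σ[ dG ∈ dom G x ]
               Σ[ dF ∈ dom F (x , g (app G x dG)) ]
                 f x ≡ app F (x , g (app G x dG)) dF))

_≡₂_ : {X₁ Y₁ X₂ Y₂ : Space} →
       (Carrier X₁ → Carrier Y₁) → (Carrier X₂ → Carrier Y₂) → Set₁
_≡₂_ {X₁} {Y₁} {X₂} {Y₂} f g =
  (_≤₂_ {X₁} {Y₁} {X₂} {Y₂} f g) × (_≤₂_ {X₂} {Y₂} {X₁} {Y₁} g f)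

module Submission where

-- Let f ≤₂ ⌈g_i⌉ via F and G.  Since G is defined everywhere, it is a
-- continuous total map ψ : X₁ → ∐ X, and its index map j = proj₁ ∘ ψ has
-- open fibres j⁻¹(i) (the preimages of the basic opens {i} × X_i).  So X₁
-- splits into the open pieces A_i = j⁻¹(i), and we take f_i = f restricted
-- to A_i (with codomain Y₁).  Then
--   * f_i ≤₂ g_i : feed the second component of ψ to g_i and post-process
--     with F, tagging the answer with the index i;
--   * f ≤₂ ⌈f_i⌉ : send x to (j x , x) and forget the tag of the answer;
--   * ⌈f_i⌉ ≤₂ f : forget the tag of the input and re-attach it to the answer.

open import Defs
open import Data.Product using (Σ; Σ-syntax; _×_; _,_; proj₁; proj₂)
open import Data.Unit using (⊤; tt)
open import Relation.Binary.PropositionalEquality using (_≡_; refl; subst; cong; sym; trans)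
open import Axiom.UniquenessOfIdentityProofs.WithK using (uip)

≐-refl : {A : Set} {U : Subset A} → U ≐ U
≐-refl x = (λ u → u) , (λ u → u)

-- Continuity of total maps: preimages of opens are open.
-- (A record, so that the spaces and the map can be inferred from it.)
record Continuous (P Q : Space) (φ : Carrier P → Carrier Q) : Set₁ where
  constructor continuous
  field preimage : ∀ V → Open Q V → Open P (λ p → V (φ p))
open Continuous public

id-continuous : (P : Space) → Continuous P P (λ p → p)
id-continuous P = continuous λ V oV → oV

∘-continuous : {P Q R : Space} {ψ : Carrier Q → Carrier R} {φ : Carrier P → Carrier Q} →
  Continuous Q R ψ → Continuous P Q φ → Continuous P R (λ p → ψ (φ p))
∘-continuous cψ cφ = continuous λ V oV → preimage cφ _ (preimage cψ V oV)

generated-continuous : (P : Space) {A : Set} {B : Subset A → Set₁} (φ : Carrier P → A) →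
  (∀ {W} → B W → Open P (λ p → W (φ p))) → Continuous P (generated A B) φ
generated-continuous P {B = B} φ base = continuous λ V oV → pull oV
  where
  pull : ∀ {W} → Gen B W → Open P (λ p → W (φ p))
  pull (gen-base b)     = base b
  pull (gen-ext gW W≐V) = open-ext P (pull gW) (λ p → W≐V (φ p))
  pull gen-⊤            = open-⊤ P
  pull (gen-∩ gU gV)    = open-∩ P (pull gU) (pull gV)
  pull (gen-⋃ J U gU)   = open-⋃ P J (λ j p → U j (φ p)) (λ j → pull (gU j))

proj₂-continuous : (P Q : Space) → Continuous (P ⊗ Q) Q proj₂
proj₂-continuous P Q = continuous λ V oV → gen-base ((λ _ → ⊤) , V , open-⊤ P , oV , λ pq → (λ v → tt , v) , proj₂)

-- φ × ψ is continuous: the preimage of a box is a box.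
⊗-continuous : {P P′ Q Q′ : Space} {φ : Carrier P → Carrier P′} {ψ : Carrier Q → Carrier Q′} →
  Continuous P P′ φ → Continuous Q Q′ ψ →
  Continuous (P ⊗ Q) (P′ ⊗ Q′) (λ pq → φ (proj₁ pq) , ψ (proj₂ pq))
⊗-continuous {P} {P′} {Q} {Q′} {φ} {ψ} cφ cψ = generated-continuous (P ⊗ Q) _ box
  where
  box : ∀ {W} → ProdBase P′ Q′ W → Open (P ⊗ Q) (λ pq → W (φ (proj₁ pq) , ψ (proj₂ pq)))
  box (U , V , oU , oV , W≐U×V) =
    gen-base (_ , _ , preimage cφ U oU , preimage cψ V oV , λ pq → W≐U×V (φ (proj₁ pq) , ψ (proj₂ pq)))

-- The injection y ↦ (i , y) of a summand into the coproduct is continuous: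
-- the preimage of {k} × U is ⋃_{e : i ≡ k} U.
inj-continuous : {I : Set} (Y : I → Space) (i : I) → Continuous (Y i) (∐ Y) (i ,_)
inj-continuous Y i = generated-continuous (Y i) (i ,_) basic
  where
  basic : ∀ {W} → CoprodBase Y W → Open (Y i) (λ y → W (i , y))
  basic (k , U , oU , W≐kU) =
    open-ext (Y i) (open-⋃ (Y i) (i ≡ k) _ (λ { refl → oU }))
      (λ y → proj₂ (W≐kU (i , y)) , proj₁ (W≐kU (i , y)))

copair-continuous : {I : Set} (X : I → Space) (Z : Space) (φ : ΣC X → Carrier Z) →
  (∀ i → Continuous (X i) Z (λ x → φ (i , x))) → Continuous (∐ X) Z φ
copair-continuous {I} X Z φ cφ = continuous λ V oV →
  gen-ext (gen-⋃ I (λ i → inj-set X i (λ x → V (φ (i , x))))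
                   (λ i → gen-base (i , _ , preimage (cφ i) V oV , ≐-refl)))
          (λ ix → (λ { (_ , refl , v) → v }) , (λ v → proj₁ ix , refl , v))

codiagonal-continuous : (I : Set) (Z : Space) → Continuous (∐ (λ (_ : I) → Z)) Z proj₂
codiagonal-continuous I Z = copair-continuous (λ _ → Z) Z proj₂ (λ _ → id-continuous Z)

-- Re-tagging: ((k , a) , y) ↦ (k , y) from ∐ A × Y to ∐_k Y; the preimage
-- of {k} × U is the box ({k} × A_k) × U.
retag-continuous : {I : Set} (A : I → Space) (Y : Space) →
  Continuous (∐ A ⊗ Y) (∐ (λ (_ : I) → Y)) (λ p → proj₁ (proj₁ p) , proj₂ p)
retag-continuous {I} A Y = generated-continuous (∐ A ⊗ Y) _ basic
  where
  basic : ∀ {W} → CoprodBase (λ (_ : I) → Y) W → Open (∐ A ⊗ Y) (λ p → W (proj₁ (proj₁ p) , proj₂ p))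
  basic (k , U , oU , W≐kU) =
    gen-base (inj-set A k (λ _ → ⊤) , U , gen-base (k , _ , open-⊤ (A k) , ≐-refl) , oU ,
              λ ((k′ , a) , y) → (λ w → to {a = a} (proj₁ (W≐kU (k′ , y)) w)) ,
                                  (λ ku → proj₂ (W≐kU (k′ , y)) (from {a = a} ku)))
    where
    to : ∀ {k′ a y} → inj-set (λ _ → Y) k U (k′ , y) → inj-set A k (λ _ → ⊤) (k′ , a) × U y
    to (refl , u) = (refl , tt) , u
    from : ∀ {k′ a y} → inj-set A k (λ _ → ⊤) (k′ , a) × U y → inj-set (λ _ → Y) k U (k′ , y)
    from ((refl , _) , u) = refl , u

⌈⌉-transport : {I : Set} (X Y : I → Space) (g : (i : I) → Carrier (X i) → Carrier (Y i))
  {k i : I} (e : k ≡ i) (z : Carrier (X k)) →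
  _≡_ {A = ΣC Y} (⌈_⌉ {I} {X} {Y} g (k , z)) (i , g i (subst (λ k → Carrier (X k)) e z))
⌈⌉-transport X Y g refl z = refl

total : {P Q : Space} → (Carrier P → Carrier Q) → PFun P Q
total φ = record { dom = λ _ → ⊤ ; app = λ p _ → φ p }

total-continuous : {P Q : Space} (φ : Carrier P → Carrier Q) →
  Continuous P Q φ → ContinuousP {P} {Q} (total φ)
total-continuous φ cφ V oV = _ , preimage cφ V oV , λ p _ → (λ v → v) , (λ v → v)

everywhere-defined-continuous : {P Q : Space} (F : PFun P Q) → ContinuousP F →
  (d : ∀ p → dom F p) → Continuous P Q (λ p → app F p (d p))
everywhere-defined-continuous {P} F cF d = continuous λ V oV →
  let (U , oU , U≐F⁻¹V) = cF V oV
  in open-ext P oU (λ p → proj₂ (U≐F⁻¹V p (d p)) , proj₁ (U≐F⁻¹V p (d p)))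

precompose : {P Q R : Space} → PFun Q R → (Carrier P → Carrier Q) → PFun P R
precompose F φ = record { dom = λ p → dom F (φ p) ; app = λ p d → app F (φ p) d }

precompose-continuous : {P Q R : Space} (F : PFun Q R) (φ : Carrier P → Carrier Q) →
  ContinuousP F → Continuous P Q φ → ContinuousP {P} {R} (precompose F φ)
precompose-continuous F φ cF cφ V oV with cF V oV
... | U , oU , U≐F⁻¹V = _ , preimage cφ U oU , λ p → U≐F⁻¹V (φ p)

app-cong : {Q R : Space} (F : PFun Q R) {a b : Carrier Q} → a ≡ b →
  (d : dom F a) (d′ : dom F b) → app F a d ≡ app F b d′
app-cong F refl d d′ = refl

reduction : {X₁ Y₁ X₂ Y₂ : Space} (f : Carrier X₁ → Carrier Y₁) (g : Carrier X₂ → Carrier Y₂)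
  (F : PFun (X₁ ⊗ Y₂) Y₁) (ψ : Carrier X₁ → Carrier X₂) →
  ContinuousP F → Continuous X₁ X₂ ψ →
  (∀ x → Σ[ d ∈ dom F (x , g (ψ x)) ] f x ≡ app F (x , g (ψ x)) d) →
  _≤₂_ {X₁} {Y₁} {X₂} {Y₂} f g
reduction f g F ψ cF cψ correct = F , total ψ , cF , total-continuous ψ cψ , λ x → tt , correct x

total-reduction : {X₁ Y₁ X₂ Y₂ : Space} (f : Carrier X₁ → Carrier Y₁) (g : Carrier X₂ → Carrier Y₂)
  (φ : Carrier (X₁ ⊗ Y₂) → Carrier Y₁) (ψ : Carrier X₁ → Carrier X₂) →
  Continuous (X₁ ⊗ Y₂) Y₁ φ → Continuous X₁ X₂ ψ →
  (∀ x → f x ≡ φ (x , g (ψ x))) → _≤₂_ {X₁} {Y₁} {X₂} {Y₂} f g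
total-reduction {X₁} {Y₁} {X₂} {Y₂} f g φ ψ cφ cψ correct =
  reduction {X₁} {Y₁} {X₂} {Y₂} f g (total φ) ψ (total-continuous φ cφ) cψ (λ x → tt , correct x)

-- The piece over k is the fibre j⁻¹(k) with the subspace topology;
-- as j⁻¹(k) is open, a subset of it is open iff it is open in X.  (Proofs
-- of j x ≡ k are unique, which makes intersections of such sets behave.)

module _ (X : Space) {I : Set} (j : Carrier X → I) (fibre-open : ∀ k → Open X (λ x → j x ≡ k)) where

  Fibre : I → Set
  Fibre k = Σ[ x ∈ Carrier X ] j x ≡ k

  over : (k : I) → Subset (Fibre k) → Subset (Carrier X)
  over k U x = Σ[ e ∈ j x ≡ k ] U (x , e)

  Piece : I → Space
  Piece k = record
    { Carrier  = Fibre k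
    ; Open     = λ U → Open X (over k U)
    ; open-ext = λ oU U≐V → open-ext X oU (λ x →
                   (λ (e , u) → e , proj₁ (U≐V (x , e)) u) , (λ (e , v) → e , proj₂ (U≐V (x , e)) v))
    ; open-⊤   = open-ext X (fibre-open k) (λ x → (λ e → e , tt) , proj₁)
    ; open-∩   = λ {U} {V} oU oV → open-ext X (open-∩ X oU oV) (λ x →
                   (λ ((e , u) , (e′ , v)) → e , u , subst (λ e″ → V (x , e″)) (uip e′ e) v) ,
                   (λ (e , u , v) → (e , u) , (e , v)))
    ; open-⋃   = λ J U oU → open-ext X (open-⋃ X J (λ i → over k (U i)) oU) (λ x →
                   (λ (i , e , u) → e , i , u) , (λ (e , i , u) → i , e , u))
    }

  piece-incl-continuous : ∀ k → Continuous (Piece k) X proj₁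
  piece-incl-continuous k = continuous λ V oV → open-∩ X (fibre-open k) oV

  subst-fibre : ∀ {k} x (e : j x ≡ k) → subst Fibre e (x , refl) ≡ (x , e)
  subst-fibre x refl = refl

  -- Sending x to its own piece, x ↦ (j x , x), is continuous into the
  -- coproduct of the pieces, since the preimage of {k} × U is `over k U`.
  assemble-continuous : Continuous X (∐ Piece) (λ x → j x , (x , refl))
  assemble-continuous = generated-continuous X _ basic
    where
    basic : ∀ {W} → CoprodBase Piece W → Open X (λ x → W (j x , (x , refl)))
    basic (k , U , oU , W≐kU) = open-ext X oU (λ x →
      (λ (e , u) → proj₂ (W≐kU _) (e , subst U (sym (subst-fibre x e)) u)) ,
      (λ w → let (e , u) = proj₁ (W≐kU _) w in e , subst U (subst-fibre x e) u))

module Tags {Z : Space} {I : Set} (X : I → Space) (ψ : Carrier Z → ΣC X) (cψ : Continuous Z (∐ X) ψ) where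

  tag : Carrier Z → I
  tag z = proj₁ (ψ z)

  -- the fibre of tag over i is the preimage of the basic open {i} × X_i
  tag-fibre-open : ∀ i → Open Z (λ z → tag z ≡ i)
  tag-fibre-open i = open-ext Z (preimage cψ _ (gen-base (i , _ , open-⊤ (X i) , ≐-refl))) (λ z → proj₁ , (λ e → e , tt))

  TagPiece : I → Space
  TagPiece = Piece Z tag tag-fibre-open

  component : (i : I) → Carrier (TagPiece i) → Carrier (X i)
  component i (z , e) = subst (λ k → Carrier (X k)) e (proj₂ (ψ z))

  -- the preimage of V under component i is that of {i} × V under ψ
  component-continuous : ∀ i → Continuous (TagPiece i) (X i) (component i)
  component-continuous i = continuous λ V oV → preimage cψ (inj-set X i V) (gen-base (i , V , oV , ≐-refl))

module Distribute (X₁ Y₁ : Space) (f : Carrier X₁ → Carrier Y₁)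
    (I : Set) (X Y : I → Space) (g : (i : I) → Carrier (X i) → Carrier (Y i))
    (red : _≤₂_ {X₁} {Y₁} {∐ X} {∐ Y} f (⌈_⌉ {I} {X} {Y} g)) where

  F : PFun (X₁ ⊗ ∐ Y) Y₁
  F = proj₁ red

  G : PFun X₁ (∐ X)
  G = proj₁ (proj₂ red)

  F-continuous : ContinuousP F
  F-continuous = proj₁ (proj₂ (proj₂ red))

  G-continuous : ContinuousP G
  G-continuous = proj₁ (proj₂ (proj₂ (proj₂ red)))

  correct : ∀ x → Σ[ dG ∈ dom G x ] Σ[ dF ∈ dom F (x , ⌈_⌉ {I} {X} {Y} g (app G x dG)) ]
                    f x ≡ app F (x , ⌈_⌉ {I} {X} {Y} g (app G x dG)) dF
  correct = proj₂ (proj₂ (proj₂ (proj₂ red)))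

  ψ : Carrier X₁ → ΣC X
  ψ x = app G x (proj₁ (correct x))

  ψ-continuous : Continuous X₁ (∐ X) ψ
  ψ-continuous = everywhere-defined-continuous G G-continuous (λ x → proj₁ (correct x))

  open Tags X ψ ψ-continuous using (TagPiece; component; component-continuous)
    renaming (tag to j; tag-fibre-open to j-fibre-open)

  A : I → Space
  A = TagPiece

  B : I → Space
  B _ = Y₁

  h : (i : I) → Carrier (A i) → Carrier (B i)
  h i (x , _) = f x

  piece-reduces : ∀ i → _≤₂_ {A i} {B i} {X i} {Y i} (h i) (g i)
  piece-reduces i =
    reduction {A i} {B i} {X i} {Y i} (h i) (g i) (precompose F embed) (component i)
      (precompose-continuous F embed F-continuous
         (⊗-continuous (piece-incl-continuous X₁ j j-fibre-open i) (inj-continuous Y i)))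
      (component-continuous i)
      (λ (x , e) → let (_ , dF , f≡F) = correct x
                       moved = cong (x ,_) (⌈⌉-transport X Y g e (proj₂ (ψ x)))
                       dF′ = subst (dom F) moved dF
                   in dF′ , trans f≡F (app-cong F moved dF dF′))
    where
    embed : Carrier (A i ⊗ Y i) → Carrier (X₁ ⊗ ∐ Y)
    embed (xe , y) = proj₁ xe , (i , y)

  f-reduces : _≤₂_ {X₁} {Y₁} {∐ A} {∐ B} f (⌈_⌉ {I} {A} {B} h)
  f-reduces =
    total-reduction {X₁} {Y₁} {∐ A} {∐ B} f (⌈_⌉ {I} {A} {B} h) (λ p → proj₂ (proj₂ p)) _
      (∘-continuous (codiagonal-continuous I Y₁) (proj₂-continuous X₁ (∐ B)))
      (assemble-continuous X₁ j j-fibre-open)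
      (λ x → refl)

  ⌈h⌉-reduces : _≤₂_ {∐ A} {∐ B} {X₁} {Y₁} (⌈_⌉ {I} {A} {B} h) f
  ⌈h⌉-reduces =
    total-reduction {∐ A} {∐ B} {X₁} {Y₁} (⌈_⌉ {I} {A} {B} h) f _ (λ p → proj₁ (proj₂ p))
      (retag-continuous A Y₁)
      (copair-continuous A X₁ _ (piece-incl-continuous X₁ j j-fibre-open))
      (λ p → refl)

theorem4p21 :
    (X₁ Y₁ : Space) (f : Carrier X₁ → Carrier Y₁)
    (I : Set) (X Y : I → Space) (g : (i : I) → Carrier (X i) → Carrier (Y i)) →
    _≤₂_ {X₁} {Y₁} {∐ X} {∐ Y} f (⌈_⌉ {I} {X} {Y} g) →
    Σ[ A ∈ (I → Space) ] Σ[ B ∈ (I → Space) ]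
      Σ[ h ∈ ((i : I) → Carrier (A i) → Carrier (B i)) ]
        ((∀ i → _≤₂_ {A i} {B i} {X i} {Y i} (h i) (g i)) ×
         _≡₂_ {X₁} {Y₁} {∐ A} {∐ B} f (⌈_⌉ {I} {A} {B} h))
theorem4p21 X₁ Y₁ f I X Y g red = A , B , h , piece-reduces , f-reduces , ⌈h⌉-reduces
  where open Distribute X₁ Y₁ f I X Y g red
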